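{- There is an effective procedure transforming any derivation $\mathcal{D}$ witnessing $\vdash_{\mathsf{GT}}\Gamma\Rightarrow \Delta$ into derivations $\mathcal{D}_\Xi$ ($\Xi\in \mathcal{R}(\Gamma)$) witnessing $\vdash_{\mathsf{GT}}\Xi\Rightarrow f[\Xi]$ for all $\Xi\in \mathcal{R}(\Gamma)$, for some $f:\mathcal{R}(\Gamma)\to \mathcal{R}(\Delta)$, and vice versa.
   Context: Classical formulas: $\alpha::=p\mid\bot\mid\neg\alpha\mid\alpha\wedge\alpha\mid\alpha\vee\alpha$; formulas of $\mathbf{PL}(\mathbin{\backslash\!\!\!/})$: $\phi::=\alpha\mid\phi\wedge\phi\mid\phi\vee\phi\mid\phi\mathbin{\backslash\!\!\!/}\phi$ ($\vee$ split disjunction, $\mathbin{\backslash\!\!\!/}$ inquisitive disjunction). $\mathsf{GT}$ ($\alpha$ classical, $\Lambda$ a multiset of classical formulas) has axioms $\Gamma,p\Rightarrow p,\Delta$, $\Gamma,\bot\Rightarrow\Delta$ and rules $\mathsf{L}\neg$ ($\Gamma\Rightarrow\alpha,\Delta$ / $\Gamma,\neg\alpha\Rightarrow\Delta$), $\mathsf{R}\neg$ ($\Gamma,\alpha\Rightarrow\Delta$ / $\Gamma\Rightarrow\neg\alpha,\Delta$), $\mathsf{L}\wedge$ ($\Gamma,\phi,\psi\Rightarrow\Delta$ / $\Gamma,\phi\wedge\psi\Rightarrow\Delta$), $\mathsf{R}\wedge$ ($\Gamma\Rightarrow\phi,\Lambda$ and $\Gamma\Rightarrow\psi,\Lambda$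 / $\Gamma\Rightarrow\phi\wedge\psi,\Lambda,\Delta$), $\mathsf{L}\vee$ ($\Gamma,\phi\Rightarrow\Lambda$ and $\Gamma,\psi\Rightarrow\Lambda$ / $\Gamma,\phi\vee\psi\Rightarrow\Lambda,\Delta$), $\mathsf{R}\vee$ ($\Gamma\Rightarrow\phi,\psi,\Delta$ / $\Gamma\Rightarrow\phi\vee\psi,\Delta$), $\mathsf{L}\mathbin{\backslash\!\!\!/}$ ($\Gamma,\chi\{\phi_L\}\Rightarrow\Delta$ and $\Gamma,\chi\{\phi_R\}\Rightarrow\Delta$ / $\Gamma,\chi\{\phi_L\mathbin{\backslash\!\!\!/}\phi_R\}\Rightarrow\Delta$), $\mathsf{R}\mathbin{\backslash\!\!\!/}$ ($\Gamma\Rightarrow\chi\{\phi_i\},\Delta$ / $\Gamma\Rightarrow\chi\{\phi_L\mathbin{\backslash\!\!\!/}\phi_R\},\Delta$), and $\mathsf{Cut}$ ($\Gamma\Rightarrow\phi,\Delta$ and $\Pi,\phi\Rightarrow\Sigma$ / $\Pi,\Gamma\Rightarrow\Delta,\Sigma$), where $\chi\{\eta\}$ replaces a fixed subformula occurrence of $\chi$ not in the scope of a negation by $\eta$. Resolutions: $\mathcal{R}(p)=\{p\}$, $\mathcal{R}(\bot)=\{\bot\}$, $\mathcal{R}(\neg\alpha)=\{\neg\beta\mid\beta\in\mathcal{R}(\alpha)\}$, $\mathcal{R}(\phi\wedge\psi)=\{\alpha\wedge\beta\mid\alpha\in\mathcal{R}(\phi),\beta\in\mathcal{R}(\psi)\}$,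 $\mathcal{R}(\phi\vee\psi)=\{\alpha\vee\beta\mid\alpha\in\mathcal{R}(\phi),\beta\in\mathcal{R}(\psi)\}$, $\mathcal{R}(\phi\mathbin{\backslash\!\!\!/}\psi)=\mathcal{R}(\phi)\cup\mathcal{R}(\psi)$; for a multiset $\Gamma$, $\mathcal{R}(\Gamma)$ is the set of multisets obtained by replacing each member of $\Gamma$ by one of its resolutions. -}

module Defs where

open import Data.Nat using (ℕ)
open import Data.List using (List; []; _∷_; _++_; map; concatMap)
open import Data.List.Relation.Unary.All using (All)
open import Data.List.Relation.Binary.Pointwise using (Pointwise)
open import Data.List.Relation.Binary.Permutation.Propositional using (_↭_)
open import Data.List.Membership.Propositional using (_∈_)

-- Raw syntax.  Propositional atoms are indexed by ℕ.
-- and = ∧, or = split disjunction ∨, ior = inquisitive disjunction.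
data Form : Set where
  at  : ℕ → Form
  bot : Form
  neg : Form → Form
  and : Form → Form → Form
  or  : Form → Form → Form
  ior : Form → Form → Form

data Classical : Form → Set where
  at  : ∀ p → Classical (at p)
  bot : Classical bot
  neg : ∀ {a} → Classical a → Classical (neg a)
  and : ∀ {a b} → Classical a → Classical b → Classical (and a b)
  or  : ∀ {a b} → Classical a → Classical b → Classical (or a b)

data WF : Form → Set where
  at  : ∀ p → WF (at p)
  bot : WF bot
  neg : ∀ {a} → Classical a → WF (neg a)
  and : ∀ {a b} → WF a → WF b → WF (and a b)
  or  : ∀ {a b} → WF a → WF b → WF (or a b)
  ior : ∀ {a b} → WF a → WF b → WF (ior a b)

-- Contexts χ{·}: a single hole, never in the scope of a negation.
data Ctx : Set where
  hole : Ctx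
  andL : Ctx → Form → Ctx
  andR : Form → Ctx → Ctx
  orL  : Ctx → Form → Ctx
  orR  : Form → Ctx → Ctx
  iorL : Ctx → Form → Ctx
  iorR : Form → Ctx → Ctx

plug : Ctx → Form → Form
plug hole     η = η
plug (andL c b) η = and (plug c η) b
plug (andR a c) η = and a (plug c η)
plug (orL c b)  η = or (plug c η) b
plug (orR a c)  η = or a (plug c η)
plug (iorL c b) η = ior (plug c η) b
plug (iorR a c) η = ior a (plug c η)

-- Sequents: antecedent and succedent are multisets, represented as lists
-- taken up to permutation (rule `exch`).  The principal formula of
-- Γ,φ is written φ ∷ Γ, and multiset union is _++_.
infix 4 _⊢_
data _⊢_ : List Form → List Form → Set where
  ax    : ∀ {Γ Δ} p → (at p ∷ Γ) ⊢ (at p ∷ Δ)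
  axBot : ∀ {Γ Δ} → (bot ∷ Γ) ⊢ Δ
  L¬    : ∀ {Γ Δ α} → Classical α → Γ ⊢ (α ∷ Δ) → (neg α ∷ Γ) ⊢ Δ
  R¬    : ∀ {Γ Δ α} → Classical α → (α ∷ Γ) ⊢ Δ → Γ ⊢ (neg α ∷ Δ)
  L∧    : ∀ {Γ Δ φ ψ} → (φ ∷ ψ ∷ Γ) ⊢ Δ → (and φ ψ ∷ Γ) ⊢ Δ
  R∧    : ∀ {Γ Λ Δ φ ψ} → All Classical Λ →
          Γ ⊢ (φ ∷ Λ) → Γ ⊢ (ψ ∷ Λ) → Γ ⊢ (and φ ψ ∷ (Λ ++ Δ))
  L∨    : ∀ {Γ Λ Δ φ ψ} → All Classical Λ →
          (φ ∷ Γ) ⊢ Λ → (ψ ∷ Γ) ⊢ Λ → (or φ ψ ∷ Γ) ⊢ (Λ ++ Δ)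
  R∨    : ∀ {Γ Δ φ ψ} → Γ ⊢ (φ ∷ ψ ∷ Δ) → Γ ⊢ (or φ ψ ∷ Δ)
  L⩔    : ∀ {Γ Δ} χ φL φR →
          (plug χ φL ∷ Γ) ⊢ Δ → (plug χ φR ∷ Γ) ⊢ Δ →
          (plug χ (ior φL φR) ∷ Γ) ⊢ Δ
  R⩔L   : ∀ {Γ Δ} χ φL φR → Γ ⊢ (plug χ φL ∷ Δ) →
          Γ ⊢ (plug χ (ior φL φR) ∷ Δ)
  R⩔R   : ∀ {Γ Δ} χ φL φR → Γ ⊢ (plug χ φR ∷ Δ) →
          Γ ⊢ (plug χ (ior φL φR) ∷ Δ)
  cut   : ∀ {Γ Δ Π Σ φ} → WF φ →
          Γ ⊢ (φ ∷ Δ) → (φ ∷ Π) ⊢ Σ → (Π ++ Γ) ⊢ (Δ ++ Σ)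
  exch  : ∀ {Γ Γ' Δ Δ'} → Γ ↭ Γ' → Δ ↭ Δ' → Γ ⊢ Δ → Γ' ⊢ Δ'

R : Form → List Form
R (at p)    = at p ∷ []
R bot       = bot ∷ []
R (neg a)   = map neg (R a)
R (and φ ψ) = concatMap (λ a → map (and a) (R ψ)) (R φ)
R (or φ ψ)  = concatMap (λ a → map (or a) (R ψ)) (R φ)
R (ior φ ψ) = R φ ++ R ψ

_∈R_ : List Form → List Form → Set
Ξ ∈R Γ = Pointwise (λ ξ φ → ξ ∈ R φ) Ξ Γ

{-# OPTIONS --safe #-}
module Submission where

-- Classical side formulas are their own unique resolution, so the classical rules act on
-- resolutions unchanged; L⩔ picks the premise whose principal formula Ξ resolves, R⩔ is
-- absorbed because R(χ{φᵢ}) ⊆ R(χ{φL ⩔ φR}), and a cut on φ becomes a cut on a (classical)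
-- resolution of φ. The resulting dependence on Ξ is made a function f by deciding membership
-- in R(Γ). Conversely, any property closed under L⩔ (resp. R⩔) in all contexts holds of φ as
-- soon as it holds of every (resp. some) resolution of φ; this rebuilds Γ ⇒ Δ one formula at
-- a time.

open import Defs
open import Level using (Level)
open import Function using (_∘_)
open import Data.Nat as ℕ using (ℕ)
open import Data.List using (List; []; _∷_; _++_; [_]; map; concatMap)
open import Data.List.Relation.Unary.All using (All; []; _∷_)
open import Data.List.Relation.Unary.Any using (here)
open import Data.List.Relation.Unary.Any.Properties using (singleton⁻)
open import Data.List.Membership.Propositional using (_∈_; find; lose)
open import Data.List.Membership.Propositional.Properties
  using (∈-++⁻; ∈-++⁺ˡ; ∈-++⁺ʳ; ∈-map⁺; ∈-map⁻; ∈-concatMap⁺; ∈-concatMap⁻)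
open import Data.List.Relation.Binary.Pointwise as Pointwise using (Pointwise; []; _∷_)
open import Data.List.Relation.Binary.Permutation.Propositional
  using (_↭_; refl; prep; swap; trans; ↭-sym)
open import Data.List.Relation.Binary.Permutation.Propositional.Properties using (shift)
open import Data.Product using (Σ; ∃; ∃₂; _×_; _,_; proj₁; proj₂; uncurry)
open import Data.Sum as Sum using (_⊎_; inj₁; inj₂; [_,_]′)
open import Relation.Binary.Definitions using (DecidableEquality)
open import Relation.Binary.PropositionalEquality using (_≡_; refl; sym; cong; cong₂; subst)
open import Relation.Nullary using (Dec; yes; no; contradiction)
open import Relation.Nullary.Decidable using (map′; _×-dec_)
open import Relation.Unary using (Decidable)

private
  variable
    a b c ℓ : Level
    A B C : Set a

∈-concatMap-map⁺ : ∀ (g : A → B → C) {xs ys x y} → x ∈ xs → y ∈ ys →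
                   g x y ∈ concatMap (λ x → map (g x) ys) xs
∈-concatMap-map⁺ g x∈ y∈ = ∈-concatMap⁺ _ (lose x∈ (∈-map⁺ (g _) y∈))

∈-concatMap-map⁻ : ∀ (g : A → B → C) xs ys {v} → v ∈ concatMap (λ x → map (g x) ys) xs →
                   ∃₂ λ x y → x ∈ xs × y ∈ ys × v ≡ g x y
∈-concatMap-map⁻ g xs ys v∈
  with x , x∈ , v∈gx ← find (∈-concatMap⁻ _ {xs} v∈)
  with y , y∈ , v≡ ← ∈-map⁻ (g x) v∈gx
  = x , y , x∈ , y∈ , v≡

Pointwise-++⁻ : ∀ {R : A → B → Set ℓ} ys {zs xs} → Pointwise R xs (ys ++ zs) →
                ∃₂ λ xs₁ xs₂ → xs ≡ xs₁ ++ xs₂ × Pointwise R xs₁ ys × Pointwise R xs₂ zs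
Pointwise-++⁻ []       rs       = [] , _ , refl , [] , rs
Pointwise-++⁻ (y ∷ ys) (r ∷ rs) with xs₁ , xs₂ , refl , rs₁ , rs₂ ← Pointwise-++⁻ ys rs =
  _ ∷ xs₁ , xs₂ , refl , r ∷ rs₁ , rs₂

Pointwise-↭ : ∀ {R : A → B → Set ℓ} {xs ys ys′} → Pointwise R xs ys → ys ↭ ys′ →
              ∃ λ xs′ → xs ↭ xs′ × Pointwise R xs′ ys′
Pointwise-↭ rs refl = _ , refl , rs
Pointwise-↭ (r ∷ rs) (prep _ p) with xs′ , q , rs′ ← Pointwise-↭ rs p = _ ∷ xs′ , prep _ q , r ∷ rs′
Pointwise-↭ (r ∷ s ∷ rs) (swap _ _ p) with xs′ , q , rs′ ← Pointwise-↭ rs p =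
  _ ∷ _ ∷ xs′ , swap _ _ q , s ∷ r ∷ rs′
Pointwise-↭ rs (trans p p′)
  with xs′ , q , rs′ ← Pointwise-↭ rs p
  with xs″ , q′ , rs″ ← Pointwise-↭ rs′ p′
  = xs″ , trans q q′ , rs″

decidable-choice : ∀ {P : A → Set ℓ} {Q : A → B → Set c} → Decidable P → B →
                   (∀ x → P x → Σ B (Q x)) → Σ (A → B) λ f → ∀ x → P x → Q x (f x)
decidable-choice {A = A} {B = B} {P = P} {Q} P? default h = f , f-correct
  where
  f : A → B
  f x with P? x
  ... | yes px = proj₁ (h x px)
  ... | no _   = default

  f-correct : ∀ x → P x → Q x (f x)
  f-correct x px with P? x
  ... | yes px′ = proj₂ (h x px′)
  ... | no ¬px  = contradiction px ¬px

tag : Form → ℕ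
tag (at _)    = 0
tag bot       = 1
tag (neg _)   = 2
tag (and _ _) = 3
tag (or _ _)  = 4
tag (ior _ _) = 5

infix 4 _≟_

_≟_ : DecidableEquality Form
sameTag : ∀ φ ψ → tag φ ≡ tag ψ → Dec (φ ≡ ψ)

φ ≟ ψ with tag φ ℕ.≟ tag ψ
... | yes tags≡ = sameTag φ ψ tags≡
... | no tags≢  = no (tags≢ ∘ cong tag)

-- Pairs of different constructors are dismissed by the coverage checker, as their tags differ.
sameTag (at p) (at q) _ = map′ (cong at) (λ { refl → refl }) (p ℕ.≟ q)
sameTag bot bot _ = yes refl
sameTag (neg α) (neg β) _ = map′ (cong neg) (λ { refl → refl }) (α ≟ β)
sameTag (and φ₁ φ₂) (and ψ₁ ψ₂) _ =
  map′ (uncurry (cong₂ and)) (λ { refl → refl , refl }) (φ₁ ≟ ψ₁ ×-dec φ₂ ≟ ψ₂)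
sameTag (or φ₁ φ₂) (or ψ₁ ψ₂) _ =
  map′ (uncurry (cong₂ or)) (λ { refl → refl , refl }) (φ₁ ≟ ψ₁ ×-dec φ₂ ≟ ψ₂)
sameTag (ior φ₁ φ₂) (ior ψ₁ ψ₂) _ =
  map′ (uncurry (cong₂ ior)) (λ { refl → refl , refl }) (φ₁ ≟ ψ₁ ×-dec φ₂ ≟ ψ₂)

open import Data.List.Membership.DecPropositional _≟_ using (_∈?_)

_∈R?_ : ∀ Ξ Γ → Dec (Ξ ∈R Γ)
_∈R?_ = Pointwise.decidable (λ ξ φ → ξ ∈? R φ)

R-classical : ∀ {α} → Classical α → R α ≡ [ α ]
R-classical (at p) = refl
R-classical bot = refl
R-classical (neg cα) rewrite R-classical cα = refl
R-classical (and cα cβ) rewrite R-classical cα | R-classical cβ = refl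
R-classical (or cα cβ) rewrite R-classical cα | R-classical cβ = refl

∈-R-classical : ∀ {α ξ} → Classical α → ξ ∈ R α → ξ ≡ α
∈-R-classical cα = singleton⁻ ∘ subst (_ ∈_) (R-classical cα)

α∈R[α] : ∀ {α} → Classical α → α ∈ R α
α∈R[α] {α} cα = subst (α ∈_) (sym (R-classical cα)) (here refl)

∈R-classical : ∀ {Λ Θ} → All Classical Λ → Θ ∈R Λ → Θ ≡ Λ
∈R-classical []         []          = refl
∈R-classical (cα ∷ cΛ) (ξ∈ ∷ Θ∈) = cong₂ _∷_ (∈-R-classical cα ξ∈) (∈R-classical cΛ Θ∈)

∈-R⇒Classical : ∀ φ {ξ} → ξ ∈ R φ → Classical ξ
∈-R⇒Classical (at p) (here refl) = at p
∈-R⇒Classical bot (here refl) = bot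
∈-R⇒Classical (neg α) ξ∈ with β , β∈ , refl ← ∈-map⁻ neg ξ∈ = neg (∈-R⇒Classical α β∈)
∈-R⇒Classical (and φ ψ) ξ∈ with α , β , α∈ , β∈ , refl ← ∈-concatMap-map⁻ and (R φ) (R ψ) ξ∈ =
  and (∈-R⇒Classical φ α∈) (∈-R⇒Classical ψ β∈)
∈-R⇒Classical (or φ ψ) ξ∈ with α , β , α∈ , β∈ , refl ← ∈-concatMap-map⁻ or (R φ) (R ψ) ξ∈ =
  or (∈-R⇒Classical φ α∈) (∈-R⇒Classical ψ β∈)
∈-R⇒Classical (ior φ ψ) ξ∈ = [ ∈-R⇒Classical φ , ∈-R⇒Classical ψ ]′ (∈-++⁻ (R φ) ξ∈)

Classical⇒WF : ∀ {α} → Classical α → WF α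
Classical⇒WF (at p) = at p
Classical⇒WF bot = bot
Classical⇒WF (neg cα) = neg cα
Classical⇒WF (and cα cβ) = and (Classical⇒WF cα) (Classical⇒WF cβ)
Classical⇒WF (or cα cβ) = or (Classical⇒WF cα) (Classical⇒WF cβ)

R-inhabited : ∀ φ → ∃ (_∈ R φ)
R-inhabited (at p) = at p , here refl
R-inhabited bot = bot , here refl
R-inhabited (neg α) = let α′ , α′∈ = R-inhabited α in neg α′ , ∈-map⁺ neg α′∈
R-inhabited (and φ ψ) =
  let α , α∈ = R-inhabited φ; β , β∈ = R-inhabited ψ in and α β , ∈-concatMap-map⁺ and α∈ β∈
R-inhabited (or φ ψ) =
  let α , α∈ = R-inhabited φ; β , β∈ = R-inhabited ψ in or α β , ∈-concatMap-map⁺ or α∈ β∈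
R-inhabited (ior φ ψ) = let α , α∈ = R-inhabited φ in α , ∈-++⁺ˡ α∈

∈R-inhabited : ∀ Δ → ∃ (_∈R Δ)
∈R-inhabited [] = [] , []
∈R-inhabited (φ ∷ Δ) =
  let α , α∈ = R-inhabited φ; Θ , Θ∈ = ∈R-inhabited Δ in α ∷ Θ , α∈ ∷ Θ∈

R-plug-⊎ : ∀ χ {X Y Z} → (∀ {ζ} → ζ ∈ R X → ζ ∈ R Y ⊎ ζ ∈ R Z) →
           ∀ {ξ} → ξ ∈ R (plug χ X) → ξ ∈ R (plug χ Y) ⊎ ξ ∈ R (plug χ Z)
R-plug-⊎ hole h = h
R-plug-⊎ (andL χ ψ) {X} h ξ∈
  with α , β , α∈ , β∈ , refl ← ∈-concatMap-map⁻ and (R (plug χ X)) (R ψ) ξ∈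
  = Sum.map (λ α∈′ → ∈-concatMap-map⁺ and α∈′ β∈) (λ α∈′ → ∈-concatMap-map⁺ and α∈′ β∈)
            (R-plug-⊎ χ h α∈)
R-plug-⊎ (andR φ χ) {X} h ξ∈
  with α , β , α∈ , β∈ , refl ← ∈-concatMap-map⁻ and (R φ) (R (plug χ X)) ξ∈
  = Sum.map (λ β∈′ → ∈-concatMap-map⁺ and α∈ β∈′) (λ β∈′ → ∈-concatMap-map⁺ and α∈ β∈′)
            (R-plug-⊎ χ h β∈)
R-plug-⊎ (orL χ ψ) {X} h ξ∈
  with α , β , α∈ , β∈ , refl ← ∈-concatMap-map⁻ or (R (plug χ X)) (R ψ) ξ∈
  = Sum.map (λ α∈′ → ∈-concatMap-map⁺ or α∈′ β∈) (λ α∈′ → ∈-concatMap-map⁺ or α∈′ β∈)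
            (R-plug-⊎ χ h α∈)
R-plug-⊎ (orR φ χ) {X} h ξ∈
  with α , β , α∈ , β∈ , refl ← ∈-concatMap-map⁻ or (R φ) (R (plug χ X)) ξ∈
  = Sum.map (λ β∈′ → ∈-concatMap-map⁺ or α∈ β∈′) (λ β∈′ → ∈-concatMap-map⁺ or α∈ β∈′)
            (R-plug-⊎ χ h β∈)
R-plug-⊎ (iorL χ ψ) h ξ∈ with ∈-++⁻ (R (plug χ _)) ξ∈
... | inj₁ ξ∈χ = Sum.map ∈-++⁺ˡ ∈-++⁺ˡ (R-plug-⊎ χ h ξ∈χ)
... | inj₂ ξ∈ψ = inj₁ (∈-++⁺ʳ _ ξ∈ψ)
R-plug-⊎ (iorR φ χ) h ξ∈ with ∈-++⁻ (R φ) ξ∈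
... | inj₁ ξ∈φ = inj₁ (∈-++⁺ˡ ξ∈φ)
... | inj₂ ξ∈χ = Sum.map (∈-++⁺ʳ (R φ)) (∈-++⁺ʳ (R φ)) (R-plug-⊎ χ h ξ∈χ)

R-plug-mono : ∀ χ {X Y} → (∀ {ζ} → ζ ∈ R X → ζ ∈ R Y) → ∀ {ξ} → ξ ∈ R (plug χ X) → ξ ∈ R (plug χ Y)
R-plug-mono χ X⊆Y = Sum.reduce ∘ R-plug-⊎ χ (inj₁ ∘ X⊆Y)

infix 4 _⊢ᴿ_

_⊢ᴿ_ : List Form → List Form → Set
Ξ ⊢ᴿ Δ = ∃ λ Θ → Θ ∈R Δ × Ξ ⊢ Θ

resolve : ∀ {Γ Δ Ξ} → Γ ⊢ Δ → Ξ ∈R Γ → Ξ ⊢ᴿ Δ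
resolve (ax {Δ = Δ} p) (here refl ∷ _) =
  let Θ , Θ∈ = ∈R-inhabited Δ in at p ∷ Θ , here refl ∷ Θ∈ , ax p
resolve (axBot {Δ = Δ}) (here refl ∷ _) =
  let Θ , Θ∈ = ∈R-inhabited Δ in Θ , Θ∈ , axBot
resolve (L¬ cα d) (ξ∈ ∷ Ξ∈)
  with refl ← ∈-R-classical (neg cα) ξ∈
  with _ ∷ Θ , α∈ ∷ Θ∈ , d′ ← resolve d Ξ∈
  with refl ← ∈-R-classical cα α∈
  = Θ , Θ∈ , L¬ cα d′
resolve (R¬ cα d) Ξ∈ with Θ , Θ∈ , d′ ← resolve d (α∈R[α] cα ∷ Ξ∈) =
  _ ∷ Θ , α∈R[α] (neg cα) ∷ Θ∈ , R¬ cα d′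
resolve (L∧ {φ = φ} {ψ} d) (ξ∈ ∷ Ξ∈)
  with α , β , α∈ , β∈ , refl ← ∈-concatMap-map⁻ and (R φ) (R ψ) ξ∈
  with Θ , Θ∈ , d′ ← resolve d (α∈ ∷ β∈ ∷ Ξ∈)
  = Θ , Θ∈ , L∧ d′
resolve (R∧ {Δ = Δ} cΛ d e) Ξ∈
  with α ∷ Λ₁ , α∈ ∷ Λ₁∈ , d′ ← resolve d Ξ∈
  with β ∷ Λ₂ , β∈ ∷ Λ₂∈ , e′ ← resolve e Ξ∈
  with refl ← ∈R-classical cΛ Λ₁∈
  with refl ← ∈R-classical cΛ Λ₂∈
  = let Θ , Θ∈ = ∈R-inhabited Δ in
    and α β ∷ Λ₁ ++ Θ , ∈-concatMap-map⁺ and α∈ β∈ ∷ Pointwise.++⁺ Λ₁∈ Θ∈ , R∧ cΛ d′ e′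
resolve (L∨ {Δ = Δ} {φ = φ} {ψ} cΛ d e) (ξ∈ ∷ Ξ∈)
  with α , β , α∈ , β∈ , refl ← ∈-concatMap-map⁻ or (R φ) (R ψ) ξ∈
  with Λ₁ , Λ₁∈ , d′ ← resolve d (α∈ ∷ Ξ∈)
  with Λ₂ , Λ₂∈ , e′ ← resolve e (β∈ ∷ Ξ∈)
  with refl ← ∈R-classical cΛ Λ₁∈
  with refl ← ∈R-classical cΛ Λ₂∈
  = let Θ , Θ∈ = ∈R-inhabited Δ in Λ₁ ++ Θ , Pointwise.++⁺ Λ₁∈ Θ∈ , L∨ cΛ d′ e′
resolve (R∨ d) Ξ∈ with α ∷ β ∷ Θ , α∈ ∷ β∈ ∷ Θ∈ , d′ ← resolve d Ξ∈ =
  or α β ∷ Θ , ∈-concatMap-map⁺ or α∈ β∈ ∷ Θ∈ , R∨ d′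
resolve (L⩔ χ φL φR d e) (ξ∈ ∷ Ξ∈) with R-plug-⊎ χ (∈-++⁻ (R φL)) ξ∈
... | inj₁ ξ∈L = resolve d (ξ∈L ∷ Ξ∈)
... | inj₂ ξ∈R = resolve e (ξ∈R ∷ Ξ∈)
resolve (R⩔L χ φL φR d) Ξ∈ with α ∷ Θ , α∈ ∷ Θ∈ , d′ ← resolve d Ξ∈ =
  α ∷ Θ , R-plug-mono χ ∈-++⁺ˡ α∈ ∷ Θ∈ , d′
resolve (R⩔R χ φL φR d) Ξ∈ with α ∷ Θ , α∈ ∷ Θ∈ , d′ ← resolve d Ξ∈ =
  α ∷ Θ , R-plug-mono χ (∈-++⁺ʳ (R φL)) α∈ ∷ Θ∈ , d′
resolve (cut {Π = Π} {φ = φ} _ d e) Ξ∈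
  with Ξ₁ , Ξ₂ , refl , Ξ₁∈ , Ξ₂∈ ← Pointwise-++⁻ Π Ξ∈
  with β ∷ Θ₁ , β∈ ∷ Θ₁∈ , d′ ← resolve d Ξ₂∈
  with Θ₂ , Θ₂∈ , e′ ← resolve e (β∈ ∷ Ξ₁∈)
  = Θ₁ ++ Θ₂ , Pointwise.++⁺ Θ₁∈ Θ₂∈ , cut (Classical⇒WF (∈-R⇒Classical φ β∈)) d′ e′
resolve (exch Γ↭ Δ↭ d) Ξ∈
  with Ξ′ , Ξ↭ , Ξ′∈ ← Pointwise-↭ Ξ∈ (↭-sym Γ↭)
  with Θ , Θ∈ , d′ ← resolve d Ξ′∈
  with Θ′ , Θ↭ , Θ′∈ ← Pointwise-↭ Θ∈ Δ↭
  = Θ′ , Θ′∈ , exch (↭-sym Ξ↭) Θ↭ d′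

⩔-Closedᴸ : (Form → Set ℓ) → Set ℓ
⩔-Closedᴸ S = ∀ χ φL φR → S (plug χ φL) → S (plug χ φR) → S (plug χ (ior φL φR))

⩔-Closedᴿ : (Form → Set ℓ) → Set ℓ
⩔-Closedᴿ S = ∀ χ φL φR → S (plug χ φL) ⊎ S (plug χ φR) → S (plug χ (ior φL φR))

-- Abstracting the sequent to a predicate S lets the induction descend into φ ∧ ψ by passing
-- to λ η → S (η ∧ ψ), which is closed because S is closed in the contexts andL χ ψ; so
-- contexts never need to be composed.
from-all-resolutions : ∀ {S : Form → Set ℓ} {φ} → WF φ → ⩔-Closedᴸ S → (∀ {α} → α ∈ R φ → S α) → S φ
from-all-resolutions (at p) _ H = H (here refl)
from-all-resolutions bot _ H = H (here refl)
from-all-resolutions (neg cα) _ H = H (α∈R[α] (neg cα))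
from-all-resolutions {S = S} (and {b = ψ} wφ wψ) closed H =
  from-all-resolutions {S = λ η → S (and η ψ)} wφ (λ χ → closed (andL χ ψ)) λ {α} α∈ →
  from-all-resolutions {S = λ η → S (and α η)} wψ (λ χ → closed (andR α χ)) λ β∈ →
  H (∈-concatMap-map⁺ and α∈ β∈)
from-all-resolutions {S = S} (or {b = ψ} wφ wψ) closed H =
  from-all-resolutions {S = λ η → S (or η ψ)} wφ (λ χ → closed (orL χ ψ)) λ {α} α∈ →
  from-all-resolutions {S = λ η → S (or α η)} wψ (λ χ → closed (orR α χ)) λ β∈ →
  H (∈-concatMap-map⁺ or α∈ β∈)
from-all-resolutions (ior {a = φ} wφ wψ) closed H =
  closed hole _ _ (from-all-resolutions wφ closed (H ∘ ∈-++⁺ˡ))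
                  (from-all-resolutions wψ closed (H ∘ ∈-++⁺ʳ (R φ)))

from-some-resolution : ∀ {S : Form → Set ℓ} {φ α} → WF φ → ⩔-Closedᴿ S → α ∈ R φ → S α → S φ
from-some-resolution (at p) _ (here refl) s = s
from-some-resolution bot _ (here refl) s = s
from-some-resolution (neg cα) _ α∈ s with refl ← ∈-R-classical (neg cα) α∈ = s
from-some-resolution {S = S} (and {a = φ} {ψ} wφ wψ) closed ξ∈ s
  with α , β , α∈ , β∈ , refl ← ∈-concatMap-map⁻ and (R φ) (R ψ) ξ∈ =
  from-some-resolution {S = λ η → S (and η ψ)} wφ (λ χ → closed (andL χ ψ)) α∈
    (from-some-resolution {S = λ η → S (and α η)} wψ (λ χ → closed (andR α χ)) β∈ s)
from-some-resolution {S = S} (or {a = φ} {ψ} wφ wψ) closed ξ∈ s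
  with α , β , α∈ , β∈ , refl ← ∈-concatMap-map⁻ or (R φ) (R ψ) ξ∈ =
  from-some-resolution {S = λ η → S (or η ψ)} wφ (λ χ → closed (orL χ ψ)) α∈
    (from-some-resolution {S = λ η → S (or α η)} wψ (λ χ → closed (orR α χ)) β∈ s)
from-some-resolution (ior {a = φ} wφ wψ) closed α∈ s with ∈-++⁻ (R φ) α∈
... | inj₁ α∈φ = closed hole _ _ (inj₁ (from-some-resolution wφ closed α∈φ s))
... | inj₂ α∈ψ = closed hole _ _ (inj₂ (from-some-resolution wψ closed α∈ψ s))

from-all-resolutions* : ∀ {Π Γ Δ} → All WF Γ → (∀ {Ξ} → Ξ ∈R Γ → Π ++ Ξ ⊢ Δ) → Π ++ Γ ⊢ Δ
from-all-resolutions* [] H = H []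
from-all-resolutions* {Π} {φ ∷ Γ} (wφ ∷ wΓ) H =
  exch (↭-sym (shift φ Π Γ)) refl (from-all-resolutions wφ L⩔ λ {α} α∈ →
    from-all-resolutions* {α ∷ Π} wΓ λ {Ξ} Ξ∈ → exch (shift α Π Ξ) refl (H (α∈ ∷ Ξ∈)))

from-some-resolution* : ∀ {Σ Δ Θ Ξ} → All WF Δ → Θ ∈R Δ → Ξ ⊢ Σ ++ Θ → Ξ ⊢ Σ ++ Δ
from-some-resolution* [] [] d = d
from-some-resolution* {Σ} {φ ∷ Δ} {α ∷ Θ} (wφ ∷ wΔ) (α∈ ∷ Θ∈) d =
  exch refl (↭-sym (shift φ Σ Δ))
    (from-some-resolution wφ (λ χ φL φR → [ R⩔L χ φL φR , R⩔R χ φL φR ]′) α∈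
      (from-some-resolution* {α ∷ Σ} wΔ Θ∈ (exch refl (shift α Σ Θ) d)))

mainTheorem10 : (Γ Δ : List Form) → All WF Γ → All WF Δ →
    (Γ ⊢ Δ →
       Σ (List Form → List Form) λ f →
         (Ξ : List Form) → Ξ ∈R Γ → (f Ξ ∈R Δ) × (Ξ ⊢ f Ξ))
    ×
    ((Σ (List Form → List Form) λ f →
         (Ξ : List Form) → Ξ ∈R Γ → (f Ξ ∈R Δ) × (Ξ ⊢ f Ξ))
       → Γ ⊢ Δ)
mainTheorem10 Γ Δ wΓ wΔ =
  (λ d → decidable-choice (_∈R? Γ) [] (λ _ → resolve d)) ,
  λ (_ , H) → from-all-resolutions* {[]} wΓ λ {Ξ} Ξ∈ →
    uncurry (from-some-resolution* {[]} wΔ) (H Ξ Ξ∈)
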